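{- In the game described in the context, suppose the codemaker answers every guess using the greedy strategy. Then for every $r\ge 0$ and every sequence of guesses of the codebreaker, $\operatorname{perm}(A^{(r)})=|P_r|$.
   Context: Game: $n$ positions, codes $[n]=\{1,\dots,n\}$; the answer is known to be a permutation of $\{1,\dots,n\}$ (viewed as a string in $[n]^n$). In each round the codebreaker submits any $x\in[n]^n$ and receives feedback in $\{\checkmark,\times\}^n$, where for an answer $y$ the true feedback is $\tau_i=\checkmark$ if $x_i=y_i$ and $\times$ otherwise. The answer set $P_r$ is the set of permutations consistent with all guesses and feedbacks of rounds $1,\dots,r$; $P_0$ is the set of all permutations. Greedy strategy (codemaker, adaptive): in round $r$, given guess $x$, set $Q_0=P_{r-1}$ and for $i=1,\dots,n$ let $S=\{a\in Q_{i-1}: a_i=x_i\}$; if $S=Q_{i-1}$ give $\tau_i=\checkmark$ and set $Q_i=Q_{i-1}$, otherwise give $\tau_i=\times$ and set $Q_i=Q_{i-1}\setminus S$; then $P_r=Q_n$. Tracking matrix: $A^{(0)}=(a^{(0)}_{ij})_{n\times n}$ has all entries $1$ (rows indexed by positions $i$, columns by codes $j$); $A^{(r)}$ is obtained from $A^{(r-1)}$ by setting $a_{i,x_i}=0$ for every position $i$ at which the round-$r$ feedback is $\times$, where $x$ is the round-$r$ guess. The permanent is $\operatorname{perm}(A)=\sum_{\sigma\in S_n}\prod_{i=1}^n a_{i,\sigma(i)}$. -}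

module Defs where

open import Data.Nat using (ℕ; zero; suc)
open import Data.Bool using (Bool; true; false; if_then_else_; not; _∧_)
open import Data.Fin using (Fin; _≟_)
open import Data.Vec using (Vec; []; _∷_; lookup; toList)
open import Data.List using (List; []; _∷_; [_]; map; concatMap; filterᵇ; filter; allFin; length)
open import Data.Nat.ListAction using (sum; product)
open import Data.Bool.ListAction using (all)
open import Data.Product using (_×_; _,_; proj₁; proj₂)
open import Relation.Nullary.Decidable using (⌊_⌋)
import Data.List.Relation.Unary.Unique.DecPropositional as UDec

-- Positions and codes are both Fin n (0-indexed versions of [n]).
-- A guess / answer string in [n]^n is a vector of length n of codes;
-- position i holds code (lookup x i).
Code : ℕ → Set
Code n = Vec (Fin n) n

-- Feedback: true = ✓, false = ×
Feedback : ℕ → Set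
Feedback n = Vec Bool n

_=ᶠ_ : ∀ {n} → Fin n → Fin n → Bool
i =ᶠ j = ⌊ i ≟ j ⌋

allStrings : (n m : ℕ) → List (Vec (Fin n) m)
allStrings n zero    = [ [] ]
allStrings n (suc m) = concatMap (λ a → map (a ∷_) (allStrings n m)) (allFin n)

isPerm : ∀ {n} → Code n → Bool
isPerm {n} y = ⌊ UDec.unique? (_≟_ {n}) (toList y) ⌋

-- the list of all permutations of [n] (each exactly once); this is P_0 and S_n
allPerms : (n : ℕ) → List (Code n)
allPerms n = filterᵇ isPerm (allStrings n n)

-- One greedy step at position i: given Q_{i-1} and guess x, return
-- (τ_i , Q_i).  S = {a ∈ Q : a_i = x_i}; S = Q iff every a ∈ Q has a_i = x_i.
greedyPos : ∀ {n} → Code n → List (Code n) → Fin n → Bool × List (Code n)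
greedyPos x Q i =
  if all (λ a → lookup a i =ᶠ lookup x i) Q
  then (true , Q)
  else (false , filterᵇ (λ a → not (lookup a i =ᶠ lookup x i)) Q)

greedyPositions : ∀ {n} → Code n → List (Code n) → List (Fin n) → List (Fin n × Bool) × List (Code n)
greedyPositions x Q [] = ([] , Q)
greedyPositions x Q (i ∷ is) with greedyPos x Q i
... | (t , Q') with greedyPositions x Q' is
...   | (fb , Q'') = ((i , t) ∷ fb , Q'')

greedyRound : ∀ {n} → List (Code n) → Code n → (Fin n → Bool) × List (Code n)
greedyRound {n} P x with greedyPositions x P (allFin n)
... | (fb , P') = (τ fb , P')
  where
    τ : List (Fin n × Bool) → Fin n → Bool
    τ []             i = true
    τ ((j , t) ∷ fb) i = if j =ᶠ i then t else τ fb i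

-- 0/1 matrices: rows = positions, columns = codes
Matrix : ℕ → Set
Matrix n = Fin n → Fin n → ℕ

A₀ : ∀ n → Matrix n
A₀ n i j = 1

updateMatrix : ∀ {n} → Matrix n → Code n → (Fin n → Bool) → Matrix n
updateMatrix A x τ i j = if not (τ i) ∧ (j =ᶠ lookup x i) then 0 else A i j

perm : ∀ {n} → Matrix n → ℕ
perm {n} A = sum (map (λ σ → product (map (λ i → A i (lookup σ i)) (allFin n))) (allPerms n))

play : ∀ {n r} → List (Code n) × Matrix n → Vec (Code n) r → List (Code n) × Matrix n
play st [] = st
play (P , A) (x ∷ xs) with greedyRound P x
... | (τ , P') = play (P' , updateMatrix A x τ) xs

P : ∀ {n r} → Vec (Code n) r → List (Code n)
P {n} xs = proj₁ (play (allPerms n , A₀ n) xs)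

A : ∀ {n r} → Vec (Code n) r → Matrix n
A {n} xs = proj₂ (play (allPerms n , A₀ n) xs)

-- The greedy codemaker answers × at position i exactly when it can delete the
-- answers a with a_i = x_i, and ✓ only when every remaining answer has a_i = x_i.
-- So P_r is the set of permutations σ avoiding every deleted pair (i , x_i),
-- i.e. the σ with a_{i,σ(i)} = 1 for all i in the 0/1 matrix A^(r); and the
-- permanent of a 0/1 matrix counts exactly these permutations.
module Submission where

open import Defs
open import Data.Nat using (ℕ; zero; suc)
open import Data.Nat.Properties using (+-identityʳ)
open import Data.Nat.ListAction using (sum; product)
open import Data.Bool using (Bool; true; false; if_then_else_; not; _∧_; _∨_)
open import Data.Bool.Properties using (∧-comm)
open import Data.Bool.ListAction using (all)
open import Data.Fin using (Fin; zero; suc; _≟_)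
open import Data.Vec using (Vec; []; _∷_; lookup)
open import Data.List using (List; []; _∷_; length; map; filterᵇ; allFin; tabulate)
open import Data.List.Properties using (map-cong)
open import Data.List.Relation.Unary.All as All using (All; []; _∷_)
open import Data.List.Relation.Unary.AllPairs using (_∷_)
open import Data.List.Relation.Unary.Unique.Propositional using (Unique)
open import Data.List.Relation.Unary.Unique.Propositional.Properties using (allFin⁺)
open import Data.Product using (_×_; _,_; proj₁; proj₂; uncurry)
open import Data.Sum using (_⊎_; inj₁; inj₂)
open import Function using (_∋_)
open import Relation.Nullary using (yes; no; contradiction)
open import Relation.Binary.PropositionalEquality
open ≡-Reasoning

positive : ℕ → Bool
positive zero    = false
positive (suc _) = true

module _ {X : Set} where

  filterᵇ-cong : ∀ {p q : X → Bool} → (∀ a → p a ≡ q a) → ∀ xs → filterᵇ p xs ≡ filterᵇ q xs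
  filterᵇ-cong p≗q []       = refl
  filterᵇ-cong {p} {q} p≗q (a ∷ xs) rewrite p≗q a with q a
  ... | true  = cong (a ∷_) (filterᵇ-cong p≗q xs)
  ... | false = filterᵇ-cong p≗q xs

  filterᵇ-const-true : ∀ (xs : List X) → filterᵇ (λ _ → true) xs ≡ xs
  filterᵇ-const-true []       = refl
  filterᵇ-const-true (a ∷ xs) = cong (a ∷_) (filterᵇ-const-true xs)

  filterᵇ-filterᵇ : ∀ (p q : X → Bool) xs →
    filterᵇ p (filterᵇ q xs) ≡ filterᵇ (λ a → q a ∧ p a) xs
  filterᵇ-filterᵇ p q []       = refl
  filterᵇ-filterᵇ p q (a ∷ xs) with q a
  ... | false = filterᵇ-filterᵇ p q xs
  ... | true with p a
  ...   | true  = cong (a ∷_) (filterᵇ-filterᵇ p q xs)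
  ...   | false = filterᵇ-filterᵇ p q xs

  length-filterᵇ : ∀ (p : X → Bool) xs →
    sum (map (λ a → if p a then 1 else 0) xs) ≡ length (filterᵇ p xs)
  length-filterᵇ p []       = refl
  length-filterᵇ p (a ∷ xs) with p a
  ... | true  = cong suc (length-filterᵇ p xs)
  ... | false = length-filterᵇ p xs

  all-cong : ∀ {p q : X → Bool} {xs} → All (λ a → p a ≡ q a) xs → all p xs ≡ all q xs
  all-cong []           = refl
  all-cong (pa≡qa ∷ eq) = cong₂ _∧_ pa≡qa (all-cong eq)

  all-∧ : ∀ (p q : X → Bool) xs → all (λ a → p a ∧ q a) xs ≡ all p xs ∧ all q xs
  all-∧ p q []       = refl
  all-∧ p q (a ∷ xs) with p a | q a
  ... | true  | true  = all-∧ p q xs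
  ... | true  | false = sym (∧-comm (all p xs) false)
  ... | false | _     = refl

  all-const-true : ∀ (xs : List X) → all (λ _ → true) xs ≡ true
  all-const-true []       = refl
  all-const-true (a ∷ xs) = all-const-true xs

  product-zeroOne : ∀ (g : X → ℕ) → (∀ a → g a ≡ 0 ⊎ g a ≡ 1) → ∀ xs →
    product (map g xs) ≡ (if all (λ a → positive (g a)) xs then 1 else 0)
  product-zeroOne g g01 []       = refl
  product-zeroOne g g01 (a ∷ xs) with g a | g01 a
  ... | .0 | inj₁ refl = refl
  ... | .1 | inj₂ refl = trans (+-identityʳ _) (product-zeroOne g g01 xs)

module _ {n : ℕ} where

  -- A copy of the function τ local to greedyRound, which cannot be named; the two are
  -- identified by their defining equations (feedbackAt-unique, with U found by unification).
  feedbackAt : List (Fin n × Bool) → Fin n → Bool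
  feedbackAt []             i = true
  feedbackAt ((j , t) ∷ fb) i = if j =ᶠ i then t else feedbackAt fb i

  module _ {X : Set} {U : X → List (Fin n × Bool) → Fin n → Bool}
    (U-[] : ∀ L i → U L [] i ≡ true)
    (U-∷ : ∀ L j t fb i → U L ((j , t) ∷ fb) i ≡ (if j =ᶠ i then t else U L fb i)) where

    feedbackAt-unique : ∀ L fb i → U L fb i ≡ feedbackAt fb i
    feedbackAt-unique L []             i = U-[] L i
    feedbackAt-unique L ((j , t) ∷ fb) i =
      trans (U-∷ L j t fb i) (cong (if j =ᶠ i then t else_) (feedbackAt-unique L fb i))

  all-feedbackAt : ∀ (f : Fin n → Bool → Bool) fb is → map proj₁ fb ≡ is → Unique is →
    all (λ i → f i (feedbackAt fb i)) is ≡ all (uncurry f) fb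
  all-feedbackAt f []             [] refl _ = refl
  all-feedbackAt f ((j , t) ∷ fb) (.j ∷ is) refl (j∉is ∷ unique) =
    cong₂ _∧_ (cong (f j) (if-self j))
      (trans (all-cong (All.map (λ j≢i → cong (f _) (if-other j≢i)) j∉is))
             (all-feedbackAt f fb is refl unique))
    where
    if-self : ∀ k → (if k =ᶠ k then t else feedbackAt fb k) ≡ t
    if-self k with k ≟ k
    ... | yes _   = refl
    ... | no k≢k = contradiction refl k≢k
    if-other : ∀ {i} → j ≢ i → (if j =ᶠ i then t else feedbackAt fb i) ≡ feedbackAt fb i
    if-other {i} j≢i with j ≟ i
    ... | yes j≡i = contradiction j≡i j≢i
    ... | no _    = refl

module _ {n : ℕ} (x : Code n) where

  respects : Code n → Fin n → Bool → Bool
  respects a i t = t ∨ not (lookup a i =ᶠ lookup x i)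

  -- Only × answers constrain: greedy answers ✓ only where all remaining answers agree with x.
  consistent : (Fin n → Bool) → Code n → Bool
  consistent τ a = all (λ i → respects a i (τ i)) (allFin n)

  greedyPos-answers : ∀ Q i →
    proj₂ (greedyPos x Q i) ≡ filterᵇ (λ a → respects a i (proj₁ (greedyPos x Q i))) Q
  greedyPos-answers Q i with all (λ a → lookup a i =ᶠ lookup x i) Q
  ... | true  = sym (filterᵇ-const-true Q)
  ... | false = refl

  greedyPositions-keys : ∀ Q is → map proj₁ (proj₁ (greedyPositions x Q is)) ≡ is
  greedyPositions-keys Q []       = refl
  greedyPositions-keys Q (i ∷ is) with greedyPos x Q i
  ... | (t , Q′) = cong (i ∷_) (greedyPositions-keys Q′ is)

  greedyPositions-answers : ∀ Q is →
    proj₂ (greedyPositions x Q is)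
      ≡ filterᵇ (λ a → all (uncurry (respects a)) (proj₁ (greedyPositions x Q is))) Q
  greedyPositions-answers Q []       = sym (filterᵇ-const-true Q)
  greedyPositions-answers Q (i ∷ is) with greedyPos x Q i | greedyPos-answers Q i
  ... | (t , Q′) | Q′≡ with greedyPositions x Q′ is | greedyPositions-answers Q′ is
  ... | (fb , Q″) | Q″≡ = begin
    Q″                                                          ≡⟨ Q″≡ ⟩
    filterᵇ (λ a → all (uncurry (respects a)) fb) Q′            ≡⟨ cong (filterᵇ _) Q′≡ ⟩
    filterᵇ (λ a → all (uncurry (respects a)) fb)
      (filterᵇ (λ a → respects a i t) Q)                        ≡⟨ filterᵇ-filterᵇ _ _ Q ⟩
    filterᵇ (λ a → respects a i t ∧ all (uncurry (respects a)) fb) Q ∎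

greedyRound-feedback : ∀ {n} (P : List (Code n)) x i →
  proj₁ (greedyRound P x) i ≡ feedbackAt (proj₁ (greedyPositions x P (allFin n))) i
greedyRound-feedback {zero} P x ()
-- Unfolding the first position separates τ's list parameter L from its recursion argument fb.
greedyRound-feedback {suc m} P x with greedyPos x P zero
... | (t , Q)
  with List (Fin (suc m) × Bool) ∋ (zero , t) ∷ proj₁ (greedyPositions x Q (tabulate suc))
     | proj₁ (greedyPositions x Q (tabulate suc))
     | feedbackAt-unique (λ _ _ → refl) (λ _ _ _ _ _ → refl)
... | L | fb | agree = λ i → cong (if zero =ᶠ i then t else_) (agree L fb i)

greedyRound-answers : ∀ {n} (P : List (Code n)) x →
  proj₂ (greedyRound P x) ≡ filterᵇ (consistent x (proj₁ (greedyRound P x))) P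
greedyRound-answers {n} P x =
  trans (greedyPositions-answers x P (allFin n)) (filterᵇ-cong (λ a → sym (consistent≡ a)) P)
  where
  fb : List (Fin n × Bool)
  fb = proj₁ (greedyPositions x P (allFin n))
  consistent≡ : ∀ a → consistent x (proj₁ (greedyRound P x)) a ≡ all (uncurry (respects x a)) fb
  consistent≡ a = begin
    all (λ i → respects x a i (proj₁ (greedyRound P x) i)) (allFin n)
      ≡⟨ all-cong (All.universal (λ i → cong (respects x a i) (greedyRound-feedback P x i)) (allFin n)) ⟩
    all (λ i → respects x a i (feedbackAt fb i)) (allFin n)
      ≡⟨ all-feedbackAt (respects x a) fb (allFin n) (greedyPositions-keys x P (allFin n)) (allFin⁺ n) ⟩
    all (uncurry (respects x a)) fb ∎

module _ {n : ℕ} where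

  ZeroOne : Matrix n → Set
  ZeroOne M = ∀ i j → M i j ≡ 0 ⊎ M i j ≡ 1

  onSupport : Matrix n → Code n → Bool
  onSupport M σ = all (λ i → positive (M i (lookup σ i))) (allFin n)

  perm-zeroOne : ∀ M → ZeroOne M → perm M ≡ length (filterᵇ (onSupport M) (allPerms n))
  perm-zeroOne M M01 = begin
    sum (map (λ σ → product (map (λ i → M i (lookup σ i)) (allFin n))) (allPerms n))
      ≡⟨ cong sum (map-cong (λ σ → product-zeroOne _ (λ i → M01 i (lookup σ i)) (allFin n)) (allPerms n)) ⟩
    sum (map (λ σ → if onSupport M σ then 1 else 0) (allPerms n))
      ≡⟨ length-filterᵇ (onSupport M) (allPerms n) ⟩
    length (filterᵇ (onSupport M) (allPerms n)) ∎

  module _ (M : Matrix n) (x : Code n) (τ : Fin n → Bool) where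

    updateMatrix-zeroOne : ZeroOne M → ZeroOne (updateMatrix M x τ)
    updateMatrix-zeroOne M01 i j with not (τ i) ∧ (j =ᶠ lookup x i)
    ... | true  = inj₁ refl
    ... | false = M01 i j

    positive-updateMatrix : ∀ σ i →
      positive (updateMatrix M x τ i (lookup σ i)) ≡ respects x σ i (τ i) ∧ positive (M i (lookup σ i))
    positive-updateMatrix σ i with τ i | lookup σ i =ᶠ lookup x i
    ... | true  | _     = refl
    ... | false | true  = refl
    ... | false | false = refl

    onSupport-updateMatrix : ∀ σ → onSupport (updateMatrix M x τ) σ ≡ onSupport M σ ∧ consistent x τ σ
    onSupport-updateMatrix σ = begin
      all (λ i → positive (updateMatrix M x τ i (lookup σ i))) (allFin n)
        ≡⟨ all-cong (All.universal (positive-updateMatrix σ) (allFin n)) ⟩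
      all (λ i → respects x σ i (τ i) ∧ positive (M i (lookup σ i))) (allFin n)
        ≡⟨ all-∧ _ _ (allFin n) ⟩
      consistent x τ σ ∧ onSupport M σ
        ≡⟨ ∧-comm (consistent x τ σ) (onSupport M σ) ⟩
      onSupport M σ ∧ consistent x τ σ ∎

  Tracks : List (Code n) × Matrix n → Set
  Tracks (Q , M) = ZeroOne M × Q ≡ filterᵇ (onSupport M) (allPerms n)

  tracks-initial : Tracks (allPerms n , A₀ n)
  tracks-initial = (λ _ _ → inj₂ refl) , sym (begin
    filterᵇ (onSupport (A₀ n)) (allPerms n)
      ≡⟨ filterᵇ-cong (λ _ → all-const-true (allFin n)) (allPerms n) ⟩
    filterᵇ (λ _ → true) (allPerms n)
      ≡⟨ filterᵇ-const-true (allPerms n) ⟩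
    allPerms n ∎)

  tracks-play : ∀ {r} (xs : Vec (Code n) r) st → Tracks st → Tracks (play st xs)
  tracks-play []       st            tracks  = tracks
  tracks-play (x ∷ xs) (Q , M) (M01 , Q≡) =
    tracks-play xs (proj₂ (greedyRound Q x) , updateMatrix M x τ)
      (updateMatrix-zeroOne M x τ M01 , Q′≡)
    where
    τ : Fin n → Bool
    τ = proj₁ (greedyRound Q x)
    Q′≡ : proj₂ (greedyRound Q x) ≡ filterᵇ (onSupport (updateMatrix M x τ)) (allPerms n)
    Q′≡ = begin
      proj₂ (greedyRound Q x)                                        ≡⟨ greedyRound-answers Q x ⟩
      filterᵇ (consistent x τ) Q                                     ≡⟨ cong (filterᵇ _) Q≡ ⟩
      filterᵇ (consistent x τ) (filterᵇ (onSupport M) (allPerms n))  ≡⟨ filterᵇ-filterᵇ _ _ (allPerms n) ⟩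
      filterᵇ (λ σ → onSupport M σ ∧ consistent x τ σ) (allPerms n)
        ≡⟨ filterᵇ-cong (λ σ → sym (onSupport-updateMatrix M x τ σ)) (allPerms n) ⟩
      filterᵇ (onSupport (updateMatrix M x τ)) (allPerms n)          ∎

lemma2 : (n r : ℕ) (guesses : Vec (Code n) r) →
    perm (A guesses) ≡ length (P guesses)
lemma2 n r guesses with tracks-play guesses (allPerms n , A₀ n) tracks-initial
... | (A01 , P≡) = trans (perm-zeroOne (A guesses) A01) (cong length (sym P≡))
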